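{- Let $m>1$ be an integer and let $\mathcal A(m)$ be the set of all $m$-extensions. The map $\mu:\mathcal A(m)\to\mathbb N^{m-1}$, $A\mapsto {\rm Kunz}^p(A)$, is surjective; that is, for every $(k_1,\dots,k_{m-1})\in\mathbb N^{m-1}$ there exists an $m$-extension $A$ with ${\rm Kunz}^p(A)=(k_1,\dots,k_{m-1})$.
   Context: $\mathbb N$ is the set of positive integers, $\mathbb N_0=\mathbb N\cup\{0\}$, and $[a,b]=\{x\in\mathbb Z: a\le x\le b\}$. For an integer $m>1$, an $m$-extension is a finite set $A\subset\mathbb N$ containing $[1,m-1]$ that admits a partition $A=A_0\cup A_1\cup\dots\cup A_t$ for some $t\in\mathbb N_0$, where $A_0=[1,m-1]$ and $A_{i+1}\subseteq m+A_i$ for all $i$. The pseudo Kunz coordinates: for $i\in[1,m-1]$ let $w_i=m+\max\{a\in A: a\equiv i\pmod m\}$ and write $w_i=mk_i+i$; then ${\rm Kunz}^p(A)=(k_1,\dots,k_{m-1})$. -}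

module Defs where

open import Data.Nat using (ℕ; zero; suc; _+_; _*_; _∸_; _≤_; _<_; NonZero)
open import Data.Nat.DivMod using (_%_)
open import Data.Fin using (Fin; toℕ)
open import Data.List using (List; []; _∷_; map; _++_; concat; upTo)
open import Data.List.Membership.Propositional using (_∈_)
open import Data.List.Relation.Unary.Unique.Propositional using (Unique)
open import Data.List.Relation.Binary.Permutation.Propositional using (_↭_)
open import Data.List.Relation.Binary.Subset.Propositional using (_⊆_)
open import Data.Product using (Σ; _×_)
open import Relation.Binary.PropositionalEquality using (_≡_)

interval1 : ℕ → List ℕ
interval1 m = map suc (upTo (m ∸ 1))

shift : ℕ → List ℕ → List ℕ
shift m xs = map (m +_) xs

data Chain (m : ℕ) : List ℕ → List (List ℕ) → Set where
  done : ∀ {prev} → Chain m prev []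
  step : ∀ {prev next rest} → next ⊆ shift m prev → Chain m next rest →
         Chain m prev (next ∷ rest)

-- A finite set A ⊂ ℕ is represented by a duplicate-free list.
-- A is an m-extension iff it admits a partition A = A₀ ∪ A₁ ∪ … ∪ Aₜ with
-- A₀ = [1,m-1] and A_{i+1} ⊆ m + A_i.  The layers A₁…Aₜ are given as a list;
-- "partition" = the concatenation of all layers is a permutation of A
-- (hence the layers are pairwise disjoint and cover A).
record IsExtension (m : ℕ) (A : List ℕ) : Set where
  field
    unique    : Unique A
    positive  : ∀ {a} → a ∈ A → 0 < a
    layers    : List (List ℕ)
    partition : (interval1 m ++ concat layers) ↭ A
    chain     : Chain m (interval1 m) layers

-- "w_i = m + max{a ∈ A : a ≡ i (mod m)} and w_i = m k_i + i",
-- where i = r ∈ [1, m-1] and k is the coordinate value.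
IsMaxInClass : (m : ℕ) .{{_ : NonZero m}} → List ℕ → ℕ → ℕ → Set
IsMaxInClass m A r a = a ∈ A × a % m ≡ r × (∀ b → b ∈ A → b % m ≡ r → b ≤ a)

KunzCoord : (m : ℕ) .{{_ : NonZero m}} → List ℕ → ℕ → ℕ → Set
KunzCoord m A r k = Σ ℕ λ a → IsMaxInClass m A r a × m + a ≡ m * k + r

-- Kunz^p(A) = (k_1, …, k_{m-1}); coordinate index j : Fin (m-1) ↔ i = j+1.
HasPseudoKunz : (m : ℕ) .{{_ : NonZero m}} → List ℕ → (Fin (m ∸ 1) → ℕ) → Set
HasPseudoKunz m A k = ∀ (j : Fin (m ∸ 1)) → KunzCoord m A (suc (toℕ j)) (k j)

{-# OPTIONS --safe #-}
-- The witness is A = {i + jm : 1 ≤ i ≤ m-1, 0 ≤ j < k_i}.  Its j-th layer consists of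
-- the residues i with k_i > j, lifted by jm; as j grows fewer residues survive, so each
-- layer lies in m + (the previous one).  The largest element of A congruent to i is
-- i + (k_i - 1)m, hence w_i = i + k_i m.
module Submission where

open import Defs
open import Data.Nat using (ℕ; zero; suc; _+_; _*_; _<_; _≤_; _∸_; NonZero; z≤n; s≤s; _<?_)
open import Data.Nat.Properties
open import Data.Nat.DivMod using (_%_; [m+kn]%n≡m%n; m<n⇒m%n≡m)
open import Data.Nat.ListAction using (sum)
open import Data.Nat.Solver using (module +-*-Solver)
open import Data.Fin using (Fin; toℕ; fromℕ<)
open import Data.Fin.Properties using (toℕ<n; fromℕ<-toℕ)
open import Data.List using (List; []; _∷_; map; _++_; concat; filter)
open import Data.List.Properties using (filter-all; map-id-local)
open import Data.List.Membership.Propositional using (_∈_)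
open import Data.List.Membership.Propositional.Properties
  using (∈-map⁺; ∈-map⁻; ∈-upTo⁺; ∈-upTo⁻; ∈-filter⁺; ∈-filter⁻; ∈-++⁺ˡ; ∈-++⁺ʳ; ∈-++⁻)
open import Data.List.Relation.Unary.Any using (here; there)
import Data.List.Relation.Unary.All as All
open import Data.List.Relation.Unary.AllPairs as AllPairs using (AllPairs)
import Data.List.Relation.Unary.AllPairs.Properties as AllPairs
open import Data.List.Relation.Binary.Permutation.Propositional using (_↭_; ↭-refl)
open import Data.List.Relation.Binary.Subset.Propositional using (_⊆_)
open import Data.Product using (Σ; ∃; ∃₂; _×_; _,_)
open import Data.Sum using (inj₁; inj₂)
open import Data.Empty using (⊥-elim)
open import Relation.Nullary using (yes; no)
open import Relation.Binary.PropositionalEquality using (_≡_; refl; sym; trans; cong; subst)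

∈⇒≤sum : ∀ {n ns} → n ∈ ns → n ≤ sum ns
∈⇒≤sum {ns = n ∷ ns} (here refl)   = m≤m+n n (sum ns)
∈⇒≤sum {ns = m ∷ ns} (there n∈ns) = ≤-trans (∈⇒≤sum n∈ns) (m≤n+m (sum ns) m)

module _ {n : ℕ} where

  ∈-interval1⁻ : ∀ {i} → i ∈ interval1 (suc n) → ∃ λ t → t < n × i ≡ suc t
  ∈-interval1⁻ i∈ with t , t∈ , refl ← ∈-map⁻ suc i∈ = t , ∈-upTo⁻ t∈ , refl

  ∈-interval1⁺ : ∀ {t} → t < n → suc t ∈ interval1 (suc n)
  ∈-interval1⁺ t<n = ∈-map⁺ suc (∈-upTo⁺ t<n)

  interval1-< : ∀ {i} → i ∈ interval1 (suc n) → i < suc n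
  interval1-< i∈ with _ , t<n , refl ← ∈-interval1⁻ i∈ = s≤s t<n

  interval1-positive : ∀ {i} → i ∈ interval1 (suc n) → 0 < i
  interval1-positive i∈ with _ , _ , refl ← ∈-interval1⁻ i∈ = s≤s z≤n

  interval1-strictlyIncreasing : AllPairs _<_ (interval1 (suc n))
  interval1-strictlyIncreasing =
    AllPairs.map⁺ (AllPairs.applyUpTo⁺₁ (λ t → t) n (λ s<t _ → s≤s s<t))

module Tower (n : ℕ) (h : ℕ → ℕ) where

  m : ℕ
  m = suc n

  residues : List ℕ
  residues = interval1 m

  level : ℕ → List ℕ
  level j = map (λ i → i + j * m) (filter (λ i → j <? h i) residues)

  levels : ℕ → ℕ → List (List ℕ)
  levels j zero    = []
  levels j (suc c) = level j ∷ levels (suc j) c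

  height : ℕ
  height = sum (map h residues)

  tower : List ℕ
  tower = concat (levels 0 (suc height))

  ∈-level⁻ : ∀ {x j} → x ∈ level j → ∃ λ i → i ∈ residues × j < h i × x ≡ i + j * m
  ∈-level⁻ {j = j} x∈ with i , i∈ , refl ← ∈-map⁻ (λ i → i + j * m) x∈
    with i∈residues , j<hi ← ∈-filter⁻ (λ i → j <? h i) i∈ = i , i∈residues , j<hi , refl

  ∈-level⁺ : ∀ {i j} → i ∈ residues → j < h i → i + j * m ∈ level j
  ∈-level⁺ {j = j} i∈ j<hi = ∈-map⁺ (λ i → i + j * m) (∈-filter⁺ (λ i → j <? h i) i∈ j<hi)

  level-suc-⊆ : ∀ j → level (suc j) ⊆ shift m (level j)
  level-suc-⊆ j x∈ with i , i∈ , j<hi , refl ← ∈-level⁻ x∈ =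
    subst (_∈ shift m (level j)) (lift-by-m i j) (∈-map⁺ (m +_) (∈-level⁺ i∈ (<-trans (n<1+n j) j<hi)))
    where
    open +-*-Solver
    lift-by-m : ∀ i j → m + (i + j * m) ≡ i + suc j * m
    lift-by-m i j = solve 3 (λ m i j → m :+ (i :+ j :* m) := i :+ (con 1 :+ j) :* m) refl m i j

  levels-chain : ∀ j c → Chain m (level j) (levels (suc j) c)
  levels-chain j zero    = done
  levels-chain j (suc c) = step (level-suc-⊆ j) (levels-chain (suc j) c)

  level-zero : (∀ {i} → i ∈ residues → 0 < h i) → level 0 ≡ residues
  level-zero h>0 = trans
    (cong (map (_+ 0)) (filter-all (λ i → 0 <? h i) (All.tabulate h>0)))
    (map-id-local (All.tabulate (λ {i} _ → +-identityʳ i)))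

  level-> : ∀ {x j} → x ∈ level j → j * m < x
  level-> {j = j} x∈ with i , i∈ , _ , refl ← ∈-level⁻ x∈ = +-monoˡ-< (j * m) (interval1-positive i∈)

  level-< : ∀ {x j} → x ∈ level j → x < suc j * m
  level-< {j = j} x∈ with i , i∈ , _ , refl ← ∈-level⁻ x∈ = +-monoˡ-< (j * m) (interval1-< i∈)

  levels-> : ∀ {x} j c → x ∈ concat (levels j c) → j * m < x
  levels-> j (suc c) x∈ with ∈-++⁻ (level j) x∈
  ... | inj₁ x∈level  = level-> x∈level
  ... | inj₂ x∈levels = ≤-<-trans (*-monoˡ-≤ m (n≤1+n j)) (levels-> (suc j) c x∈levels)

  levels-strictlyIncreasing : ∀ j c → AllPairs _<_ (concat (levels j c))
  levels-strictlyIncreasing j zero    = AllPairs.[]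
  levels-strictlyIncreasing j (suc c) = AllPairs.++⁺ level-increasing
    (levels-strictlyIncreasing (suc j) c)
    (All.tabulate λ x∈ → All.tabulate λ y∈ → <-trans (level-< x∈) (levels-> (suc j) c y∈))
    where
    level-increasing : AllPairs _<_ (level j)
    level-increasing = AllPairs.map⁺ (AllPairs.filter⁺ (λ i → j <? h i)
      (AllPairs.map (+-monoˡ-< (j * m)) (interval1-strictlyIncreasing {n})))

  ∈-levels⁻ : ∀ {x} j c → x ∈ concat (levels j c) → ∃ λ t → x ∈ level t
  ∈-levels⁻ j (suc c) x∈ with ∈-++⁻ (level j) x∈
  ... | inj₁ x∈level  = j , x∈level
  ... | inj₂ x∈levels = ∈-levels⁻ (suc j) c x∈levels

  ∈-levels⁺ : ∀ {x t} s c → x ∈ level t → s ≤ t → t < s + c → x ∈ concat (levels s c)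
  ∈-levels⁺ s zero    _  s≤t t<s+0 = ⊥-elim (<⇒≱ t<s+0 (≤-trans (≤-reflexive (+-identityʳ s)) s≤t))
  ∈-levels⁺ {t = t} s (suc c) x∈ s≤t t<s+c with m≤n⇒m<n∨m≡n s≤t
  ... | inj₂ refl = ∈-++⁺ˡ x∈
  ... | inj₁ s<t  = ∈-++⁺ʳ (level s) (∈-levels⁺ (suc s) c x∈ s<t (subst (t <_) (+-suc s c) t<s+c))

  ∈-tower⁻ : ∀ {x} → x ∈ tower → ∃₂ λ i j → i ∈ residues × j < h i × x ≡ i + j * m
  ∈-tower⁻ x∈ with j , x∈level ← ∈-levels⁻ 0 (suc height) x∈
    with i , i∈ , j<hi , x≡ ← ∈-level⁻ x∈level = i , j , i∈ , j<hi , x≡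

  ∈-tower⁺ : ∀ {i j} → i ∈ residues → j < h i → i + j * m ∈ tower
  ∈-tower⁺ i∈ j<hi = ∈-levels⁺ 0 (suc height) (∈-level⁺ i∈ j<hi) z≤n
    (s≤s (≤-trans (<⇒≤ j<hi) (∈⇒≤sum (∈-map⁺ h i∈))))

  tower-isExtension : (∀ {i} → i ∈ residues → 0 < h i) → IsExtension m tower
  tower-isExtension h>0 = record
    { unique    = AllPairs.map <⇒≢ (levels-strictlyIncreasing 0 (suc height))
    ; positive  = positive
    ; layers    = levels 1 height
    ; partition = subst (λ A₀ → (residues ++ concat (levels 1 height)) ↭ (A₀ ++ concat (levels 1 height)))
                    (sym (level-zero h>0)) ↭-refl
    ; chain     = subst (λ A₀ → Chain m A₀ (levels 1 height)) (level-zero h>0) (levels-chain 0 height)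
    }
    where
    positive : ∀ {x} → x ∈ tower → 0 < x
    positive x∈ with i , j , i∈ , _ , refl ← ∈-tower⁻ x∈ =
      <-≤-trans (interval1-positive i∈) (m≤m+n i (j * m))

  residue-of : ∀ {i} j → i ∈ residues → (i + j * m) % m ≡ i
  residue-of {i} j i∈ = trans ([m+kn]%n≡m%n i j m) (m<n⇒m%n≡m (interval1-< i∈))

  tower-isMaxInClass : ∀ {r k} → r ∈ residues → h r ≡ suc k → IsMaxInClass m tower r (r + k * m)
  tower-isMaxInClass {r} {k} r∈ hr≡ =
    ∈-tower⁺ r∈ (subst (k <_) (sym hr≡) ≤-refl) , residue-of k r∈ , maximal
    where
    maximal : ∀ x → x ∈ tower → x % m ≡ r → x ≤ r + k * m
    maximal x x∈ x%m≡r with i , j , i∈ , j<hi , refl ← ∈-tower⁻ x∈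
      with refl ← trans (sym (residue-of j i∈)) x%m≡r =
      +-monoʳ-≤ i (*-monoˡ-≤ m (≤-pred (subst (j <_) hr≡ j<hi)))

  tower-kunzCoord : ∀ {r} → r ∈ residues → 0 < h r → KunzCoord m tower r (h r)
  tower-kunzCoord {r} r∈ hr>0 with h r in hr≡ | hr>0
  ... | suc k | _ = r + k * m , tower-isMaxInClass r∈ hr≡ , w≡
    where
    open +-*-Solver
    w≡ : m + (r + k * m) ≡ m * suc k + r
    w≡ = solve 3 (λ m r k → m :+ (r :+ k :* m) := m :* (con 1 :+ k) :+ r) refl m r k

-- k j sits at residue toℕ j + 1; junk value 0 outside [1, n].
onResidues : ∀ {n} → (Fin n → ℕ) → ℕ → ℕ
onResidues         k zero = 0
onResidues {n = n} k (suc t) with t <? n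
... | yes t<n = k (fromℕ< t<n)
... | no  _   = 0

onResidues-suc-toℕ : ∀ {n} (k : Fin n → ℕ) j → onResidues k (suc (toℕ j)) ≡ k j
onResidues-suc-toℕ {n} k j with toℕ j <? n
... | yes j<n = cong k (fromℕ<-toℕ j j<n)
... | no  j≮n = ⊥-elim (j≮n (toℕ<n j))

onResidues-positive : ∀ {n} {k : Fin n → ℕ} → (∀ j → 0 < k j) →
                      ∀ {i} → i ∈ interval1 (suc n) → 0 < onResidues k i
onResidues-positive {n} k>0 i∈ with t , t<n , refl ← ∈-interval1⁻ i∈ with t <? n
... | yes _   = k>0 _
... | no  t≮n = ⊥-elim (t≮n t<n)

theorem3p4 : (m : ℕ) → 1 < m → .{{_ : NonZero m}} →
    (k : Fin (m ∸ 1) → ℕ) → (∀ j → 0 < k j) →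
    Σ (List ℕ) λ A → IsExtension m A × HasPseudoKunz m A k
theorem3p4 (suc zero)    (s≤s ()) _ _
theorem3p4 (suc (suc n)) _        k k>0 = tower , tower-isExtension h>0 , kunz
  where
  open Tower (suc n) (onResidues k)
  h>0 : ∀ {i} → i ∈ residues → 0 < onResidues k i
  h>0 = onResidues-positive k>0
  kunz : HasPseudoKunz m tower k
  kunz j = subst (KunzCoord m tower (suc (toℕ j))) (onResidues-suc-toℕ k j)
                 (tower-kunzCoord j+1∈ (h>0 j+1∈))
    where
    j+1∈ : suc (toℕ j) ∈ residues
    j+1∈ = ∈-interval1⁺ (toℕ<n j)
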